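{- Let $r,M,N$ be positive integers. Then \[ \sum_{i=1}^{N}\frac{q^{2^i r}\,u_{2^{i+M}r-2^i r}\,u_{2^{i+M}r+2^i r}}{u_{2^i r}^2\,u_{2^{i+M}r}^2}=\sum_{i=1}^{M}\frac{q^{2^i r}\,u_{2^{i+N}r-2^i r}\,u_{2^{i+N}r+2^i r}}{u_{2^i r}^2\,u_{2^{i+N}r}^2}, \] \[ \sum_{i=1}^{N}\frac{q^{2^i r}\,u_{2^{i+M}r-2^i r}\,u_{2^{i+M}r+2^i r}}{v_{2^i r}^2\,v_{2^{i+M}r}^2}=\sum_{i=1}^{M}\frac{q^{2^i r}\,u_{2^{i+N}r-2^i r}\,u_{2^{i+N}r+2^i r}}{v_{2^i r}^2\,v_{2^{i+N}r}^2}, \] and, for either choice of sign (the same on both sides), \[ \sum_{i=1}^{2N}\frac{(\pm1)^i q^{2^i r}\,u_{2^{i+2M}r-2^i r}\,u_{2^{i+2M}r+2^i r}}{u_{2^i r}^2\,u_{2^{i+2M}r}^2}=\sum_{i=1}^{2M}\frac{(\pm1)^i q^{2^i r}\,u_{2^{i+2N}r-2^i r}\,u_{2^{i+2N}r+2^i r}}{u_{2^i r}^2\,u_{2^{i+2N}r}^2}, \] \[ \sum_{i=1}^{2N}\frac{(\pm1)^i q^{2^i r}\,u_{2^{i+2M}r-2^i r}\,u_{2^{i+2M}r+2^i r}}{v_{2^i r}^2\,v_{2^{i+2M}r}^2}=\sum_{i=1}^{2M}\frac{(\pm1)^i q^{2^i r}\,u_{2^{i+2N}r-2^i r}\,u_{2^{i+2N}r+2^i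 r}}{v_{2^i r}^2\,v_{2^{i+2N}r}^2}. \]
   Context: Let $p,q$ be complex numbers. The Lucas sequences $u_n=u_n(p,q)$ and $v_n=v_n(p,q)$ are defined by $u_0=0$, $u_1=1$, $v_0=2$, $v_1=p$, and $x_n=px_{n-1}-qx_{n-2}$ for $x\in\{u,v\}$. Let $\alpha,\beta$ be the roots of $x^2-px+q=0$, labeled so that $|\alpha|>|\beta|$, with discriminant $D=p^2-4q\neq0$; thus $\alpha+\beta=p$, $\alpha\beta=q$, $\alpha-\beta=\sqrt D$, and $u_n=(\alpha^n-\beta^n)/(\alpha-\beta)$, $v_n=\alpha^n+\beta^n$. As implicit in the statement, all denominators appearing are assumed nonzero. -}

module Defs where

open import Level using (Level; suc; _⊔_)
open import Algebra.Bundles using (CommutativeRing)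
open import Relation.Nullary using (¬_)
open import Data.Nat as ℕ using (ℕ; zero)
import Data.Nat

-- A field: a commutative ring with 0 ≠ 1 and a (total) inverse map that is
-- a two-sided inverse on nonzero elements (convention 0⁻¹ = 0, only used to
-- make division a total operation; all divisors in the statement are assumed
-- nonzero).
record Field (c ℓ : Level) : Set (suc (c ⊔ ℓ)) where
  field
    commutativeRing : CommutativeRing c ℓ
  open CommutativeRing commutativeRing public
  field
    _⁻¹        : Carrier → Carrier
    ⁻¹-cong    : ∀ {x y} → x ≈ y → x ⁻¹ ≈ y ⁻¹
    ⁻¹-inverse : ∀ x → ¬ (x ≈ 0#) → x * x ⁻¹ ≈ 1#
    0⁻¹≈0      : 0# ⁻¹ ≈ 0#
    0≉1        : ¬ (0# ≈ 1#)

  infixl 7 _/_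
  _/_ : Carrier → Carrier → Carrier
  x / y = x * y ⁻¹

  infixr 8 _^_
  _^_ : Carrier → ℕ → Carrier
  x ^ zero    = 1#
  x ^ ℕ.suc n = x * x ^ n

  Σ[1…_] : ℕ → (ℕ → Carrier) → Carrier
  Σ[1… zero  ] f = 0#
  Σ[1… ℕ.suc n ] f = Σ[1… n ] f + f (ℕ.suc n)

module Lucas {c ℓ : Level} (F : Field c ℓ) (p q : Field.Carrier F) where
  open Field F

  u : ℕ → Carrier
  u zero                = 0#
  u (ℕ.suc zero)        = 1#
  u (ℕ.suc (ℕ.suc n))   = p * u (ℕ.suc n) - q * u n

  v : ℕ → Carrier
  v zero                = 1# + 1#
  v (ℕ.suc zero)        = p
  v (ℕ.suc (ℕ.suc n))   = p * v (ℕ.suc n) - q * v n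

  D : Carrier
  D = p * p - (1# + 1# + 1# + 1#) * q

  e : ℕ → ℕ → ℕ
  e k r = (2 Data.Nat.^ k) Data.Nat.* r

  num : ℕ → ℕ → ℕ → Carrier
  num r K i = q ^ e i r * u (e (i Data.Nat.+ K) r Data.Nat.∸ e i r)
                        * u (e (i Data.Nat.+ K) r Data.Nat.+ e i r)

  denU : ℕ → ℕ → ℕ → Carrier
  denU r K i = u (e i r) ^ 2 * u (e (i Data.Nat.+ K) r) ^ 2

  denV : ℕ → ℕ → ℕ → Carrier
  denV r K i = v (e i r) ^ 2 * v (e (i Data.Nat.+ K) r) ^ 2

-- By Catalan's identity  q^k u_{n-k} u_{n+k} = q^k u_n² - q^n u_k²  and its
-- companion  D q^k u_{n-k} u_{n+k} = q^k v_n² - q^n v_k²  (from v_n² - D u_n² = 4qⁿ),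
-- the i-th summand with k = 2^i r, n = 2^{i+K} r is h(i) - h(i+K), where
-- h(j) = q^{2^j r}/u_{2^j r}²  (resp. D⁻¹ q^{2^j r}/v_{2^j r}²).  The sum is then
-- Σ_{i≤N} h + Σ_{i≤M} h - Σ_{i≤N+M} h, symmetric in M and N.  With the sign
-- (±1)^i, since (±1)^{2M} = 1 the sequence (±1)^j h(j) plays the role of h.
-- Catalan's identity comes from the Casoratian x_n y_{n+1} - x_{n+1} y_n of two
-- solutions of the Lucas recurrence, which is geometric with ratio q.

module Submission where

open import Defs
open import Data.Nat using (ℕ; _≤_)
import Data.Nat as ℕ
open import Data.Product using (_×_)
open import Data.Sum using (_⊎_)
open import Relation.Nullary using (¬_)

open import Algebra.Bundles using (CommutativeRing)
open import Algebra.Solver.Ring.AlmostCommutativeRing using (_-Raw-AlmostCommutative⟶_; fromCommutativeRing)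
open import Data.Integer as ℤ using (ℤ; +_; -[1+_]; sign; ∣_∣; _◃_)
import Data.Integer.Properties as ℤP
open import Data.Maybe using (Maybe; just; nothing)
open import Data.Nat using (zero; suc; z≤n; s≤s)
import Data.Nat.Properties as ℕP
open import Data.Product using (_,_)
open import Data.Sign as S using (Sign)
open import Data.Sum using (inj₁; inj₂)
import Relation.Binary.PropositionalEquality as P
open import Relation.Nullary using (yes; no)

-- The ring solver needs a coefficient ring with decidable equality; the
-- field itself has none, so coefficients are integers mapped into the ring.
-- The TC-optimised multiple n ×ᴿ 1# computes 1 ×ᴿ 1# to 1#, so solver constants
-- coincide definitionally with the literals 1#, 1# + 1#, … in the goals.
module IntegerRingSolver {c ℓ} (R : CommutativeRing c ℓ) where
  open CommutativeRing R
  open import Algebra.Properties.Ring ring using (-‿+-comm; -‿involutive; -0#≈0#; -‿distribˡ-*; -‿distribʳ-*)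
  open import Algebra.Properties.Semiring.Mult.TCOptimised semiring using (1+×; ×-homo-+; ×1-homo-*) renaming (_×_ to _×ᴿ_)
  open import Relation.Binary.Reasoning.Setoid setoid

  ⟦_⟧ℤ : ℤ → Carrier
  ⟦ + n ⟧ℤ      = n ×ᴿ 1#
  ⟦ -[1+ n ] ⟧ℤ = - (suc n ×ᴿ 1#)

  +-cancelˡ-− : ∀ x y z → (x + y) - (x + z) ≈ y - z
  +-cancelˡ-− x y z = begin
    (x + y) + - (x + z)   ≈⟨ +-congˡ (-‿+-comm x z) ⟨
    (x + y) + (- x + - z) ≈⟨ +-congʳ (+-comm x y) ⟩
    (y + x) + (- x + - z) ≈⟨ +-assoc y x _ ⟩
    y + (x + (- x + - z)) ≈⟨ +-congˡ (+-assoc x (- x) _) ⟨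
    y + ((x + - x) + - z) ≈⟨ +-congˡ (+-congʳ (-‿inverseʳ x)) ⟩
    y + (0# + - z)        ≈⟨ +-congˡ (+-identityˡ _) ⟩
    y - z                 ∎

  ⊖-homo : ∀ m n → ⟦ m ℤ.⊖ n ⟧ℤ ≈ m ×ᴿ 1# - n ×ᴿ 1#
  ⊖-homo m zero = begin
    ⟦ m ℤ.⊖ 0 ⟧ℤ   ≡⟨ P.cong ⟦_⟧ℤ (ℤP.⊖-≥ {m} z≤n) ⟩
    m ×ᴿ 1#        ≈⟨ +-identityʳ _ ⟨
    m ×ᴿ 1# + 0#   ≈⟨ +-congˡ -0#≈0# ⟨
    m ×ᴿ 1# - 0#   ∎
  ⊖-homo zero (suc n) = sym (+-identityˡ _)
  ⊖-homo (suc m) (suc n) = begin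
    ⟦ suc m ℤ.⊖ suc n ⟧ℤ            ≡⟨ P.cong ⟦_⟧ℤ (ℤP.[1+m]⊖[1+n]≡m⊖n m n) ⟩
    ⟦ m ℤ.⊖ n ⟧ℤ                    ≈⟨ ⊖-homo m n ⟩
    m ×ᴿ 1# - n ×ᴿ 1#                 ≈⟨ +-cancelˡ-− 1# _ _ ⟨
    (1# + m ×ᴿ 1#) - (1# + n ×ᴿ 1#)   ≈⟨ +-cong (1+× m 1#) (-‿cong (1+× n 1#)) ⟨
    suc m ×ᴿ 1# - suc n ×ᴿ 1#         ∎

  +-homo : ∀ i j → ⟦ i ℤ.+ j ⟧ℤ ≈ ⟦ i ⟧ℤ + ⟦ j ⟧ℤ
  +-homo (+ m)    (+ n)    = ×-homo-+ 1# m n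
  +-homo (+ m)    -[1+ n ] = ⊖-homo m (suc n)
  +-homo -[1+ m ] (+ n)    = trans (⊖-homo n (suc m)) (+-comm _ _)
  +-homo -[1+ m ] -[1+ n ] = begin
    - (suc (suc (m ℕ.+ n)) ×ᴿ 1#)        ≡⟨ P.cong (λ k → - (suc k ×ᴿ 1#)) (ℕP.+-suc m n) ⟨
    - ((suc m ℕ.+ suc n) ×ᴿ 1#)          ≈⟨ -‿cong (×-homo-+ 1# (suc m) (suc n)) ⟩
    - (suc m ×ᴿ 1# + suc n ×ᴿ 1#)         ≈⟨ -‿+-comm _ _ ⟨
    - (suc m ×ᴿ 1#) + - (suc n ×ᴿ 1#)     ∎

  -‿homo : ∀ i → ⟦ ℤ.- i ⟧ℤ ≈ - ⟦ i ⟧ℤ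
  -‿homo -[1+ n ]  = sym (-‿involutive _)
  -‿homo (+ zero)  = sym -0#≈0#
  -‿homo (+ suc n) = refl

  signed : Sign → Carrier → Carrier
  signed S.+ x = x
  signed S.- x = - x

  ⟦⟧-signAbs : ∀ i → ⟦ i ⟧ℤ ≈ signed (sign i) (∣ i ∣ ×ᴿ 1#)
  ⟦⟧-signAbs (+ n)    = refl
  ⟦⟧-signAbs -[1+ n ] = refl

  ◃-homo : ∀ s n → ⟦ s ◃ n ⟧ℤ ≈ signed s (n ×ᴿ 1#)
  ◃-homo S.+ zero    = refl
  ◃-homo S.- zero    = sym -0#≈0#
  ◃-homo S.+ (suc n) = refl
  ◃-homo S.- (suc n) = refl

  signed-cong : ∀ s {x y} → x ≈ y → signed s x ≈ signed s y
  signed-cong S.+ x≈y = x≈y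
  signed-cong S.- x≈y = -‿cong x≈y

  signed-* : ∀ s t x y → signed (s S.* t) (x * y) ≈ signed s x * signed t y
  signed-* S.+ S.+ x y = refl
  signed-* S.+ S.- x y = -‿distribʳ-* x y
  signed-* S.- S.+ x y = -‿distribˡ-* x y
  signed-* S.- S.- x y = begin
    x * y       ≈⟨ -‿involutive _ ⟨
    - - (x * y) ≈⟨ -‿cong (-‿distribʳ-* x y) ⟩
    - (x * - y) ≈⟨ -‿distribˡ-* x _ ⟩
    - x * - y   ∎

  *-homo : ∀ i j → ⟦ i ℤ.* j ⟧ℤ ≈ ⟦ i ⟧ℤ * ⟦ j ⟧ℤ
  *-homo i j = begin
    ⟦ (sign i S.* sign j) ◃ (∣ i ∣ ℕ.* ∣ j ∣) ⟧ℤ            ≈⟨ ◃-homo (sign i S.* sign j) (∣ i ∣ ℕ.* ∣ j ∣) ⟩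
    signed (sign i S.* sign j) ((∣ i ∣ ℕ.* ∣ j ∣) ×ᴿ 1#)       ≈⟨ signed-cong (sign i S.* sign j) (×1-homo-* ∣ i ∣ ∣ j ∣) ⟩
    signed (sign i S.* sign j) ((∣ i ∣ ×ᴿ 1#) * (∣ j ∣ ×ᴿ 1#))  ≈⟨ signed-* (sign i) (sign j) _ _ ⟩
    signed (sign i) (∣ i ∣ ×ᴿ 1#) * signed (sign j) (∣ j ∣ ×ᴿ 1#) ≈⟨ *-cong (⟦⟧-signAbs i) (⟦⟧-signAbs j) ⟨
    ⟦ i ⟧ℤ * ⟦ j ⟧ℤ                                          ∎

  ℤ⟶R : ℤ.+-*-rawRing -Raw-AlmostCommutative⟶ fromCommutativeRing R
  ℤ⟶R = record
    { ⟦_⟧ = ⟦_⟧ℤ ; +-homo = +-homo ; *-homo = *-homo ; -‿homo = -‿homo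
    ; 0-homo = refl ; 1-homo = refl }

  ≟-reflected : ∀ i j → Maybe (⟦ i ⟧ℤ ≈ ⟦ j ⟧ℤ)
  ≟-reflected i j with i ℤ.≟ j
  ... | yes P.refl = just refl
  ... | no _       = nothing

  open import Algebra.Solver.Ring ℤ.+-*-rawRing (fromCommutativeRing R) ℤ⟶R ≟-reflected public

module FieldProperties {c ℓ} (F : Field c ℓ) where
  open Field F
  open IntegerRingSolver commutativeRing
  open import Relation.Binary.Reasoning.Setoid setoid

  ^-homo-* : ∀ x m n → x ^ (m ℕ.+ n) ≈ x ^ m * x ^ n
  ^-homo-* x zero    n = sym (*-identityˡ _)
  ^-homo-* x (suc m) n = trans (*-congˡ (^-homo-* x m n)) (sym (*-assoc _ _ _))

  x*x≈1⇒x^[2n]≈1 : ∀ {x} → x * x ≈ 1# → ∀ n → x ^ (2 ℕ.* n) ≈ 1#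
  x*x≈1⇒x^[2n]≈1     x*x≈1 zero    = refl
  x*x≈1⇒x^[2n]≈1 {x} x*x≈1 (suc n) = begin
    x ^ (2 ℕ.* suc n)         ≡⟨ P.cong (x ^_) (ℕP.*-suc 2 n) ⟩
    x * (x * x ^ (2 ℕ.* n))   ≈⟨ *-assoc x x _ ⟨
    x * x * x ^ (2 ℕ.* n)     ≈⟨ *-cong x*x≈1 (x*x≈1⇒x^[2n]≈1 x*x≈1 n) ⟩
    1# * 1#                   ≈⟨ *-identityˡ 1# ⟩
    1#                        ∎

  ±1*±1≈1 : ∀ {s} → s ≈ 1# ⊎ s ≈ - 1# → s * s ≈ 1#
  ±1*±1≈1 (inj₁ s≈1)  = trans (*-cong s≈1 s≈1) (*-identityˡ 1#)
  ±1*±1≈1 (inj₂ s≈-1) = trans (*-cong s≈-1 s≈-1) (solve 0 (:- con (+ 1) :* :- con (+ 1) := con (+ 1)) refl)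

  x*y≉0⇒x≉0 : ∀ {x y} → ¬ (x * y ≈ 0#) → ¬ (x ≈ 0#)
  x*y≉0⇒x≉0 {x} {y} xy≉0 x≈0 = xy≉0 (trans (*-congʳ x≈0) (zeroˡ y))

  x*y≉0⇒y≉0 : ∀ {x y} → ¬ (x * y ≈ 0#) → ¬ (y ≈ 0#)
  x*y≉0⇒y≉0 {x} {y} xy≉0 y≈0 = xy≉0 (trans (*-congˡ y≈0) (zeroʳ x))

  ⁻¹-inverseˡ : ∀ x → ¬ (x ≈ 0#) → x ⁻¹ * x ≈ 1#
  ⁻¹-inverseˡ x x≉0 = trans (*-comm _ _) (⁻¹-inverse x x≉0)

  *-inverseʳ-unique : ∀ x y → x * y ≈ 1# → y ≈ x ⁻¹
  *-inverseʳ-unique x y xy≈1 = begin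
    y                 ≈⟨ *-identityʳ y ⟨
    y * 1#            ≈⟨ *-congˡ (⁻¹-inverse x x≉0) ⟨
    y * (x * x ⁻¹)    ≈⟨ solve 3 (λ X Y X⁻¹ → Y :* (X :* X⁻¹) := (X :* Y) :* X⁻¹) refl x y (x ⁻¹) ⟩
    (x * y) * x ⁻¹    ≈⟨ *-congʳ xy≈1 ⟩
    1# * x ⁻¹         ≈⟨ *-identityˡ _ ⟩
    x ⁻¹              ∎
    where
    x≉0 : ¬ (x ≈ 0#)
    x≉0 x≈0 = 0≉1 (trans (sym (zeroˡ y)) (trans (*-congʳ (sym x≈0)) xy≈1))

  ⁻¹-homo-* : ∀ x y → ¬ (x ≈ 0#) → ¬ (y ≈ 0#) → (x * y) ⁻¹ ≈ x ⁻¹ * y ⁻¹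
  ⁻¹-homo-* x y x≉0 y≉0 = sym (*-inverseʳ-unique (x * y) (x ⁻¹ * y ⁻¹) (begin
    (x * y) * (x ⁻¹ * y ⁻¹)   ≈⟨ solve 4 (λ X Y X⁻¹ Y⁻¹ → (X :* Y) :* (X⁻¹ :* Y⁻¹) := (X :* X⁻¹) :* (Y :* Y⁻¹)) refl x y (x ⁻¹) (y ⁻¹) ⟩
    (x * x ⁻¹) * (y * y ⁻¹)   ≈⟨ *-cong (⁻¹-inverse x x≉0) (⁻¹-inverse y y≉0) ⟩
    1# * 1#                   ≈⟨ *-identityˡ 1# ⟩
    1#                        ∎))

  *-cancelˡ-⁻¹ : ∀ {d x y} → ¬ (d ≈ 0#) → d * x ≈ y → x ≈ d ⁻¹ * y
  *-cancelˡ-⁻¹ {d} {x} {y} d≉0 dx≈y = begin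
    x                ≈⟨ *-identityˡ x ⟨
    1# * x           ≈⟨ *-congʳ (⁻¹-inverseˡ d d≉0) ⟨
    (d ⁻¹ * d) * x   ≈⟨ *-assoc _ _ _ ⟩
    d ⁻¹ * (d * x)   ≈⟨ *-congˡ dx≈y ⟩
    d ⁻¹ * y         ∎

  cross-/ : ∀ x y a b → ¬ (a * b ≈ 0#) → (x * b - y * a) / (a * b) ≈ x / a - y / b
  cross-/ x y a b ab≉0 = begin
    (x * b - y * a) * (a * b) ⁻¹
      ≈⟨ *-congˡ (⁻¹-homo-* a b a≉0 b≉0) ⟩
    (x * b - y * a) * (a ⁻¹ * b ⁻¹)
      ≈⟨ solve 6 (λ X Y A B A⁻¹ B⁻¹ → (X :* B :- Y :* A) :* (A⁻¹ :* B⁻¹)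
                                  := X :* A⁻¹ :* (B :* B⁻¹) :- Y :* B⁻¹ :* (A :* A⁻¹)) refl x y a b (a ⁻¹) (b ⁻¹) ⟩
    x * a ⁻¹ * (b * b ⁻¹) - y * b ⁻¹ * (a * a ⁻¹)
      ≈⟨ +-cong (*-congˡ (⁻¹-inverse b b≉0)) (-‿cong (*-congˡ (⁻¹-inverse a a≉0))) ⟩
    x * a ⁻¹ * 1# - y * b ⁻¹ * 1#
      ≈⟨ +-cong (*-identityʳ _) (-‿cong (*-identityʳ _)) ⟩
    x / a - y / b ∎
    where
    a≉0 = x*y≉0⇒x≉0 ab≉0
    b≉0 = x*y≉0⇒y≉0 ab≉0

  Σ-cong : ∀ n {f g : ℕ → Carrier} → (∀ i → 1 ≤ i → i ≤ n → f i ≈ g i) → Σ[1… n ] f ≈ Σ[1… n ] g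
  Σ-cong zero    f≈g = refl
  Σ-cong (suc n) f≈g = +-cong (Σ-cong n (λ i 1≤i i≤n → f≈g i 1≤i (ℕP.m≤n⇒m≤1+n i≤n))) (f≈g (suc n) (s≤s z≤n) ℕP.≤-refl)

  Σ-telescope : ∀ N M (h : ℕ → Carrier) →
    Σ[1… N ] (λ i → h i - h (i ℕ.+ M)) ≈ Σ[1… N ] h + Σ[1… M ] h - Σ[1… N ℕ.+ M ] h
  Σ-telescope zero    M h = solve 1 (λ S → con (+ 0) := con (+ 0) :+ S :- S) refl (Σ[1… M ] h)
  Σ-telescope (suc N) M h = begin
    Σ[1… N ] (λ i → h i - h (i ℕ.+ M)) + (h (suc N) - h (suc N ℕ.+ M))
      ≈⟨ +-congʳ (Σ-telescope N M h) ⟩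
    Σ[1… N ] h + Σ[1… M ] h - Σ[1… N ℕ.+ M ] h + (h (suc N) - h (suc N ℕ.+ M))
      ≈⟨ solve 5 (λ SN SM SNM a b → SN :+ SM :- SNM :+ (a :- b) := SN :+ a :+ SM :- (SNM :+ b))
                 refl (Σ[1… N ] h) (Σ[1… M ] h) (Σ[1… N ℕ.+ M ] h) (h (suc N)) (h (suc N ℕ.+ M)) ⟩
    Σ[1… suc N ] h + Σ[1… M ] h - Σ[1… suc N ℕ.+ M ] h ∎

  Σ-telescope-swap : ∀ N M (h : ℕ → Carrier) →
    Σ[1… N ] (λ i → h i - h (i ℕ.+ M)) ≈ Σ[1… M ] (λ i → h i - h (i ℕ.+ N))
  Σ-telescope-swap N M h = begin
    Σ[1… N ] (λ i → h i - h (i ℕ.+ M))            ≈⟨ Σ-telescope N M h ⟩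
    Σ[1… N ] h + Σ[1… M ] h - Σ[1… N ℕ.+ M ] h    ≡⟨ P.cong (λ k → Σ[1… N ] h + Σ[1… M ] h - Σ[1… k ] h) (ℕP.+-comm N M) ⟩
    Σ[1… N ] h + Σ[1… M ] h - Σ[1… M ℕ.+ N ] h    ≈⟨ +-congʳ (+-comm _ _) ⟩
    Σ[1… M ] h + Σ[1… N ] h - Σ[1… M ℕ.+ N ] h    ≈⟨ Σ-telescope M N h ⟨
    Σ[1… M ] (λ i → h i - h (i ℕ.+ N))            ∎

  telescoping-sums-swap : ∀ (t : ℕ → ℕ → Carrier) (h : ℕ → Carrier) M N →
    (∀ i → 1 ≤ i → i ≤ N → t M i ≈ h i - h (i ℕ.+ M)) →
    (∀ i → 1 ≤ i → i ≤ M → t N i ≈ h i - h (i ℕ.+ N)) →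
    Σ[1… N ] (t M) ≈ Σ[1… M ] (t N)
  telescoping-sums-swap t h M N tM≈ tN≈ =
    trans (Σ-cong N tM≈) (trans (Σ-telescope-swap N M h) (sym (Σ-cong M tN≈)))

  signed-difference : ∀ {s K x y} (g : ℕ → Carrier) i → s ^ K ≈ 1# → x / y ≈ g i - g (i ℕ.+ K) →
    s ^ i * x / y ≈ s ^ i * g i - s ^ (i ℕ.+ K) * g (i ℕ.+ K)
  signed-difference {s} {K} {x} {y} g i s^K≈1 x/y≈ = begin
    s ^ i * x * y ⁻¹                          ≈⟨ *-assoc _ _ _ ⟩
    s ^ i * (x / y)                           ≈⟨ *-congˡ x/y≈ ⟩
    s ^ i * (g i - g (i ℕ.+ K))               ≈⟨ solve 3 (λ S A B → S :* (A :- B) := S :* A :- S :* con (+ 1) :* B) refl (s ^ i) (g i) (g (i ℕ.+ K)) ⟩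
    s ^ i * g i - s ^ i * 1# * g (i ℕ.+ K)    ≈⟨ +-congˡ (-‿cong (*-congʳ (trans (*-congˡ (sym s^K≈1)) (sym (^-homo-* s i K))))) ⟩
    s ^ i * g i - s ^ (i ℕ.+ K) * g (i ℕ.+ K) ∎

  alternating-sums-swap : ∀ {s} → s * s ≈ 1# → ∀ (x y : ℕ → ℕ → Carrier) (h : ℕ → Carrier) M N →
    (∀ i → 1 ≤ i → i ≤ 2 ℕ.* N → x (2 ℕ.* M) i / y (2 ℕ.* M) i ≈ h i - h (i ℕ.+ 2 ℕ.* M)) →
    (∀ i → 1 ≤ i → i ≤ 2 ℕ.* M → x (2 ℕ.* N) i / y (2 ℕ.* N) i ≈ h i - h (i ℕ.+ 2 ℕ.* N)) →
    Σ[1… 2 ℕ.* N ] (λ i → s ^ i * x (2 ℕ.* M) i / y (2 ℕ.* M) i)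
      ≈ Σ[1… 2 ℕ.* M ] (λ i → s ^ i * x (2 ℕ.* N) i / y (2 ℕ.* N) i)
  alternating-sums-swap {s} s*s≈1 x y h M N tM≈ tN≈ =
    telescoping-sums-swap (λ K i → s ^ i * x K i / y K i) (λ j → s ^ j * h j) (2 ℕ.* M) (2 ℕ.* N)
      (λ i 1≤i i≤2N → signed-difference h i (x*x≈1⇒x^[2n]≈1 s*s≈1 M) (tM≈ i 1≤i i≤2N))
      (λ i 1≤i i≤2M → signed-difference h i (x*x≈1⇒x^[2n]≈1 s*s≈1 N) (tN≈ i 1≤i i≤2M))

module LucasProperties {c ℓ} (F : Field c ℓ) (p q : Field.Carrier F) where
  open Field F
  open Lucas F p q
  open FieldProperties F
  open IntegerRingSolver commutativeRing
  open import Relation.Binary.Reasoning.Setoid setoid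

  IsLucasSequence : (ℕ → Carrier) → Set ℓ
  IsLucasSequence x = ∀ n → x (suc (suc n)) ≈ p * x (suc n) - q * x n

  casoratian : (ℕ → Carrier) → (ℕ → Carrier) → ℕ → Carrier
  casoratian x y n = x n * y (suc n) - x (suc n) * y n

  module _ {x y : ℕ → Carrier} (x-rec : IsLucasSequence x) (y-rec : IsLucasSequence y) where

    casoratian-geometric : ∀ n → casoratian x y n ≈ q ^ n * casoratian x y 0
    casoratian-geometric zero    = sym (*-identityˡ _)
    casoratian-geometric (suc n) = begin
      x (suc n) * y (suc (suc n)) - x (suc (suc n)) * y (suc n)
        ≈⟨ +-cong (*-congˡ (y-rec n)) (-‿cong (*-congʳ (x-rec n))) ⟩
      x (suc n) * (p * y (suc n) - q * y n) - (p * x (suc n) - q * x n) * y (suc n)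
        ≈⟨ solve 6 (λ X₁ X₀ Y₁ Y₀ P Q → X₁ :* (P :* Y₁ :- Q :* Y₀) :- (P :* X₁ :- Q :* X₀) :* Y₁
                                      := Q :* (X₀ :* Y₁ :- X₁ :* Y₀)) refl (x (suc n)) (x n) (y (suc n)) (y n) p q ⟩
      q * casoratian x y n                 ≈⟨ *-congˡ (casoratian-geometric n) ⟩
      q * (q ^ n * casoratian x y 0)       ≈⟨ *-assoc _ _ _ ⟨
      q ^ suc n * casoratian x y 0         ∎

    casoratian-shift : ∀ k n → x n * y (k ℕ.+ n) - x (k ℕ.+ n) * y n ≈ u k * casoratian x y n
    casoratian-shift zero n =
      solve 3 (λ X Y C → X :* Y :- X :* Y := con (+ 0) :* C) refl (x n) (y n) (casoratian x y n)
    casoratian-shift (suc zero) n = sym (*-identityˡ _)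
    casoratian-shift (suc (suc k)) n = begin
      x n * y (suc (suc (k ℕ.+ n))) - x (suc (suc (k ℕ.+ n))) * y n
        ≈⟨ +-cong (*-congˡ (y-rec (k ℕ.+ n))) (-‿cong (*-congʳ (x-rec (k ℕ.+ n)))) ⟩
      x n * (p * y (suc (k ℕ.+ n)) - q * y (k ℕ.+ n)) - (p * x (suc (k ℕ.+ n)) - q * x (k ℕ.+ n)) * y n
        ≈⟨ solve 8 (λ X Y X₁ Y₁ X₀ Y₀ P Q → X :* (P :* Y₁ :- Q :* Y₀) :- (P :* X₁ :- Q :* X₀) :* Y
                                         := P :* (X :* Y₁ :- X₁ :* Y) :- Q :* (X :* Y₀ :- X₀ :* Y))
                   refl (x n) (y n) (x (suc (k ℕ.+ n))) (y (suc (k ℕ.+ n))) (x (k ℕ.+ n)) (y (k ℕ.+ n)) p q ⟩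
      p * (x n * y (suc k ℕ.+ n) - x (suc k ℕ.+ n) * y n) - q * (x n * y (k ℕ.+ n) - x (k ℕ.+ n) * y n)
        ≈⟨ +-cong (*-congˡ (casoratian-shift (suc k) n)) (-‿cong (*-congˡ (casoratian-shift k n))) ⟩
      p * (u (suc k) * C) - q * (u k * C)
        ≈⟨ solve 5 (λ P Q A B C′ → P :* (A :* C′) :- Q :* (B :* C′) := (P :* A :- Q :* B) :* C′) refl p q (u (suc k)) (u k) C ⟩
      u (suc (suc k)) * C ∎
      where C = casoratian x y n

  u-rec : IsLucasSequence u
  u-rec n = refl

  v-rec : IsLucasSequence v
  v-rec n = refl

  catalan : ∀ m k → u m * u (k ℕ.+ m ℕ.+ k) ≈ u (k ℕ.+ m) ^ 2 - q ^ m * u k ^ 2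
  catalan m k = begin
    u m * u (k ℕ.+ m ℕ.+ k)
      ≈⟨ solve 2 (λ X A → X := A :* (A :* con (+ 1)) :+ (X :- A :* A)) refl (u m * u (k ℕ.+ m ℕ.+ k)) (u (k ℕ.+ m)) ⟩
    u (k ℕ.+ m) ^ 2 + (u m * u (k ℕ.+ m ℕ.+ k) - u (k ℕ.+ m) * u (k ℕ.+ m))
      ≡⟨ P.cong (λ j → u (k ℕ.+ m) ^ 2 + (u m * u (k ℕ.+ m ℕ.+ k) - u (k ℕ.+ m) * u j)) (ℕP.+-comm k m) ⟩
    u (k ℕ.+ m) ^ 2 + (u m * u (k ℕ.+ m ℕ.+ k) - u (k ℕ.+ m) * u (m ℕ.+ k))
      ≈⟨ +-congˡ (casoratian-shift u-rec u+k-rec k m) ⟩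
    u (k ℕ.+ m) ^ 2 + u k * casoratian u u+k m
      ≈⟨ +-congˡ (*-congˡ (casoratian-geometric u-rec u+k-rec m)) ⟩
    u (k ℕ.+ m) ^ 2 + u k * (q ^ m * (0# * u (suc k) - 1# * u k))
      ≈⟨ solve 4 (λ A Q K K′ → A :+ K :* (Q :* (con (+ 0) :* K′ :- con (+ 1) :* K)) := A :- Q :* (K :* (K :* con (+ 1))))
                 refl (u (k ℕ.+ m) ^ 2) (q ^ m) (u k) (u (suc k)) ⟩
    u (k ℕ.+ m) ^ 2 - q ^ m * u k ^ 2 ∎
    where
    u+k : ℕ → Carrier
    u+k j = u (j ℕ.+ k)
    u+k-rec : IsLucasSequence u+k
    u+k-rec j = refl

  catalan-numerator : ∀ {k n} → k ≤ n → q ^ k * u (n ℕ.∸ k) * u (n ℕ.+ k) ≈ q ^ k * u n ^ 2 - q ^ n * u k ^ 2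
  catalan-numerator {k} {n} k≤n =
    P.subst (λ t → q ^ k * u (n ℕ.∸ k) * u (t ℕ.+ k) ≈ q ^ k * u t ^ 2 - q ^ t * u k ^ 2)
            (ℕP.m+[n∸m]≡n k≤n) (begin
      q ^ k * u m * u (k ℕ.+ m ℕ.+ k)        ≈⟨ *-assoc _ _ _ ⟩
      q ^ k * (u m * u (k ℕ.+ m ℕ.+ k))      ≈⟨ *-congˡ (catalan m k) ⟩
      q ^ k * (u (k ℕ.+ m) ^ 2 - q ^ m * u k ^ 2)
        ≈⟨ solve 4 (λ Qᵏ Qᵐ A B → Qᵏ :* (A :- Qᵐ :* B) := Qᵏ :* A :- Qᵏ :* Qᵐ :* B) refl (q ^ k) (q ^ m) (u (k ℕ.+ m) ^ 2) (u k ^ 2) ⟩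
      q ^ k * u (k ℕ.+ m) ^ 2 - q ^ k * q ^ m * u k ^ 2
        ≈⟨ +-congˡ (-‿cong (*-congʳ (^-homo-* q k m))) ⟨
      q ^ k * u (k ℕ.+ m) ^ 2 - q ^ (k ℕ.+ m) * u k ^ 2 ∎)
    where m = n ℕ.∸ k

  v≈2u-pu : ∀ n → v n ≈ (1# + 1#) * u (suc n) - p * u n
  v≈2u-pu zero = solve 1 (λ P → con (+ 2) := con (+ 2) :* con (+ 1) :- P :* con (+ 0)) refl p
  v≈2u-pu (suc zero) =
    solve 2 (λ P Q → P := con (+ 2) :* (P :* con (+ 1) :- Q :* con (+ 0)) :- P :* con (+ 1)) refl p q
  v≈2u-pu (suc (suc n)) = begin
    p * v (suc n) - q * v n
      ≈⟨ +-cong (*-congˡ (v≈2u-pu (suc n))) (-‿cong (*-congˡ (v≈2u-pu n))) ⟩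
    p * ((1# + 1#) * u (suc (suc n)) - p * u (suc n)) - q * ((1# + 1#) * u (suc n) - p * u n)
      ≈⟨ solve 4 (λ P Q A B → P :* (con (+ 2) :* (P :* A :- Q :* B) :- P :* A) :- Q :* (con (+ 2) :* A :- P :* B)
                            := con (+ 2) :* (P :* (P :* A :- Q :* B) :- Q :* A) :- P :* (P :* A :- Q :* B)) refl p q (u (suc n)) (u n) ⟩
    (1# + 1#) * u (suc (suc (suc n))) - p * u (suc (suc n)) ∎

  -- The Casoratian of u and v is −2qⁿ.
  D*u²≈v²-4qⁿ : ∀ n → D * u n ^ 2 ≈ v n ^ 2 - (1# + 1# + 1# + 1#) * q ^ n
  D*u²≈v²-4qⁿ n = begin
    D * u n ^ 2
      ≈⟨ solve 4 (λ P Q A B → (P :* P :- con (+ 4) :* Q) :* (B :* (B :* con (+ 1)))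
                            := (con (+ 2) :* A :- P :* B) :* ((con (+ 2) :* A :- P :* B) :* con (+ 1))
                               :+ con (+ 2) :* (B :* (con (+ 2) :* (P :* A :- Q :* B) :- P :* A) :- A :* (con (+ 2) :* A :- P :* B)))
                 refl p q (u (suc n)) (u n) ⟩
    V n ^ 2 + (1# + 1#) * (u n * V (suc n) - u (suc n) * V n)
      ≈⟨ +-cong (*-cong (sym (v≈2u-pu n)) (*-congʳ (sym (v≈2u-pu n))))
                (*-congˡ (+-cong (*-congˡ (sym (v≈2u-pu (suc n)))) (-‿cong (*-congˡ (sym (v≈2u-pu n)))))) ⟩
    v n ^ 2 + (1# + 1#) * casoratian u v n
      ≈⟨ +-congˡ (*-congˡ (casoratian-geometric u-rec v-rec n)) ⟩
    v n ^ 2 + (1# + 1#) * (q ^ n * (0# * p - 1# * (1# + 1#)))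
      ≈⟨ solve 3 (λ A P Q → A :+ con (+ 2) :* (Q :* (con (+ 0) :* P :- con (+ 1) :* con (+ 2))) := A :- con (+ 4) :* Q)
                 refl (v n ^ 2) p (q ^ n) ⟩
    v n ^ 2 - (1# + 1# + 1# + 1#) * q ^ n ∎
    where
    V : ℕ → Carrier
    V j = (1# + 1#) * u (suc j) - p * u j

  catalan-numeratorᵥ : ∀ {k n} → k ≤ n → D * (q ^ k * u (n ℕ.∸ k) * u (n ℕ.+ k)) ≈ q ^ k * v n ^ 2 - q ^ n * v k ^ 2
  catalan-numeratorᵥ {k} {n} k≤n = begin
    D * (q ^ k * u (n ℕ.∸ k) * u (n ℕ.+ k))      ≈⟨ *-congˡ (catalan-numerator k≤n) ⟩
    D * (q ^ k * u n ^ 2 - q ^ n * u k ^ 2)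
      ≈⟨ solve 5 (λ D′ Qᵏ Qⁿ A B → D′ :* (Qᵏ :* A :- Qⁿ :* B) := Qᵏ :* (D′ :* A) :- Qⁿ :* (D′ :* B)) refl D (q ^ k) (q ^ n) (u n ^ 2) (u k ^ 2) ⟩
    q ^ k * (D * u n ^ 2) - q ^ n * (D * u k ^ 2)
      ≈⟨ +-cong (*-congˡ (D*u²≈v²-4qⁿ n)) (-‿cong (*-congˡ (D*u²≈v²-4qⁿ k))) ⟩
    q ^ k * (v n ^ 2 - four * q ^ n) - q ^ n * (v k ^ 2 - four * q ^ k)
      ≈⟨ solve 5 (λ Qᵏ Qⁿ A B Four → Qᵏ :* (A :- Four :* Qⁿ) :- Qⁿ :* (B :- Four :* Qᵏ) := Qᵏ :* A :- Qⁿ :* B)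
                 refl (q ^ k) (q ^ n) (v n ^ 2) (v k ^ 2) four ⟩
    q ^ k * v n ^ 2 - q ^ n * v k ^ 2 ∎
    where four = 1# + 1# + 1# + 1#

  ratioᵤ ratioᵥ : ℕ → Carrier
  ratioᵤ n = q ^ n / u n ^ 2
  ratioᵥ n = D ⁻¹ * q ^ n / v n ^ 2

  e-mono : ∀ r K i → e i r ≤ e (i ℕ.+ K) r
  e-mono r K i = ℕP.*-monoˡ-≤ r (ℕP.^-monoʳ-≤ 2 (ℕP.m≤m+n i K))

  termᵤ-telescopes : ∀ r K i → ¬ (denU r K i ≈ 0#) → num r K i / denU r K i ≈ ratioᵤ (e i r) - ratioᵤ (e (i ℕ.+ K) r)
  termᵤ-telescopes r K i den≉0 =
    trans (*-congʳ (catalan-numerator (e-mono r K i))) (cross-/ _ _ _ _ den≉0)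

  termᵥ-telescopes : ¬ (D ≈ 0#) → ∀ r K i → ¬ (denV r K i ≈ 0#) → num r K i / denV r K i ≈ ratioᵥ (e i r) - ratioᵥ (e (i ℕ.+ K) r)
  termᵥ-telescopes D≉0 r K i den≉0 = trans (*-congʳ num≈) (cross-/ _ _ _ _ den≉0)
    where
    k = e i r
    n = e (i ℕ.+ K) r
    num≈ : num r K i ≈ D ⁻¹ * q ^ k * v n ^ 2 - D ⁻¹ * q ^ n * v k ^ 2
    num≈ = trans (*-cancelˡ-⁻¹ D≉0 (catalan-numeratorᵥ (e-mono r K i)))
      (solve 5 (λ D⁻¹ Qᵏ Qⁿ A B → D⁻¹ :* (Qᵏ :* A :- Qⁿ :* B) := D⁻¹ :* Qᵏ :* A :- D⁻¹ :* Qⁿ :* B) refl (D ⁻¹) (q ^ k) (q ^ n) (v n ^ 2) (v k ^ 2))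

corollary31 : ∀ {c ℓ} (F : Field c ℓ) → let open Field F in
    (p q : Carrier) → let open Lucas F p q in
    ¬ (D ≈ 0#) →
    (r M N : ℕ) → 1 ≤ r → 1 ≤ M → 1 ≤ N →
    (((∀ i → 1 ≤ i → i ≤ N → ¬ (denU r M i ≈ 0#)) →
      (∀ i → 1 ≤ i → i ≤ M → ¬ (denU r N i ≈ 0#)) →
      Σ[1… N ] (λ i → num r M i / denU r M i)
        ≈ Σ[1… M ] (λ i → num r N i / denU r N i))
    × ((∀ i → 1 ≤ i → i ≤ N → ¬ (denV r M i ≈ 0#)) →
      (∀ i → 1 ≤ i → i ≤ M → ¬ (denV r N i ≈ 0#)) →
      Σ[1… N ] (λ i → num r M i / denV r M i)
        ≈ Σ[1… M ] (λ i → num r N i / denV r N i))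
    × (∀ (s : Carrier) → (s ≈ 1# ⊎ s ≈ - 1#) →
      (∀ i → 1 ≤ i → i ≤ (2 ℕ.* N) → ¬ (denU r ((2 ℕ.* M)) i ≈ 0#)) →
      (∀ i → 1 ≤ i → i ≤ (2 ℕ.* M) → ¬ (denU r ((2 ℕ.* N)) i ≈ 0#)) →
      Σ[1… (2 ℕ.* N) ] (λ i → s ^ i * num r ((2 ℕ.* M)) i / denU r ((2 ℕ.* M)) i)
        ≈ Σ[1… (2 ℕ.* M) ] (λ i → s ^ i * num r ((2 ℕ.* N)) i / denU r ((2 ℕ.* N)) i))
    × (∀ (s : Carrier) → (s ≈ 1# ⊎ s ≈ - 1#) →
      (∀ i → 1 ≤ i → i ≤ (2 ℕ.* N) → ¬ (denV r ((2 ℕ.* M)) i ≈ 0#)) →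
      (∀ i → 1 ≤ i → i ≤ (2 ℕ.* M) → ¬ (denV r ((2 ℕ.* N)) i ≈ 0#)) →
      Σ[1… (2 ℕ.* N) ] (λ i → s ^ i * num r ((2 ℕ.* M)) i / denV r ((2 ℕ.* M)) i)
        ≈ Σ[1… (2 ℕ.* M) ] (λ i → s ^ i * num r ((2 ℕ.* N)) i / denV r ((2 ℕ.* N)) i)))
corollary31 F p q D≉0 r M N _ _ _ =
    (λ hN hM → telescoping-sums-swap (λ K i → num r K i / denU r K i) hᵤ M N (telescopesᵤ hN) (telescopesᵤ hM))
  , (λ hN hM → telescoping-sums-swap (λ K i → num r K i / denV r K i) hᵥ M N (telescopesᵥ hN) (telescopesᵥ hM))
  , (λ s s≈±1 hN hM → alternating-sums-swap (±1*±1≈1 s≈±1) (num r) (denU r) hᵤ M N (telescopesᵤ hN) (telescopesᵤ hM))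
  , (λ s s≈±1 hN hM → alternating-sums-swap (±1*±1≈1 s≈±1) (num r) (denV r) hᵥ M N (telescopesᵥ hN) (telescopesᵥ hM))
  where
  open Field F
  open Lucas F p q
  open FieldProperties F
  open LucasProperties F p q

  hᵤ hᵥ : ℕ → Carrier
  hᵤ i = ratioᵤ (e i r)
  hᵥ i = ratioᵥ (e i r)

  telescopesᵤ : ∀ {K n} → (∀ i → 1 ≤ i → i ≤ n → ¬ (denU r K i ≈ 0#)) →
    ∀ i → 1 ≤ i → i ≤ n → num r K i / denU r K i ≈ hᵤ i - hᵤ (i ℕ.+ K)
  telescopesᵤ den≉0 i 1≤i i≤n = termᵤ-telescopes r _ i (den≉0 i 1≤i i≤n)

  telescopesᵥ : ∀ {K n} → (∀ i → 1 ≤ i → i ≤ n → ¬ (denV r K i ≈ 0#)) →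
    ∀ i → 1 ≤ i → i ≤ n → num r K i / denV r K i ≈ hᵥ i - hᵥ (i ℕ.+ K)
  telescopesᵥ den≉0 i 1≤i i≤n = termᵥ-telescopes D≉0 r _ i (den≉0 i 1≤i i≤n)
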